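{- Let \(X\) be a poset with carrier in a universe \(\mathcal U\) and let \(\mathcal V\) be any universe. Then \(X\) has suprema for all \(\mathcal V\)-covered subsets \(X\to\Omega_{\mathcal U\sqcup\mathcal V}\) if and only if \(X\) has suprema for all families \(I\to X\) with \(I:\mathcal V\).
   Context: Work in univalent foundations (intensional Martin-Löf type theory with universes, function and propositional extensionality, propositional truncations). A poset is a type with a proposition-valued reflexive, transitive, antisymmetric relation. \(\Omega_{\mathcal T}\) is the type of propositions in \(\mathcal T\); a subset of \(X\) is a map \(S:X\to\Omega_{\mathcal T}\), with total space \(\mathbb T(S):=\Sigma_{x:X}(x\in S)\); a supremum of \(S\) is a least upper bound of the elements \(x\) with \(S(x)\). \(S\) is \(\mathcal V\)-covered if there is a type \(I:\mathcal V\) with a surjection \(e:I\to\mathbb T(S)\) (for every element of \(\mathbb T(S)\) there merely exists a preimage). -}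

module Defs where

open import Level using (Level; _⊔_; suc; Setω)
open import Data.Product using (Σ; _×_; _,_; proj₁; proj₂)
open import Relation.Binary.PropositionalEquality using (_≡_)
open import Axiom.Extensionality.Propositional using (Extensionality)

is-prop : ∀ {ℓ} → Set ℓ → Set ℓ
is-prop A = (x y : A) → x ≡ y

FunExt : Setω
FunExt = ∀ {a b} → Extensionality a b

record PropTrunc : Setω where
  field
    ∥_∥        : ∀ {ℓ} → Set ℓ → Set ℓ
    ∥∥-is-prop : ∀ {ℓ} {A : Set ℓ} → is-prop ∥ A ∥
    ∣_∣        : ∀ {ℓ} {A : Set ℓ} → A → ∥ A ∥
    ∥∥-rec     : ∀ {ℓ ℓ'} {A : Set ℓ} {P : Set ℓ'} → is-prop P → (A → P) → ∥ A ∥ → P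

record Poset (𝓤 𝓣 : Level) : Set (suc (𝓤 ⊔ 𝓣)) where
  field
    Carrier   : Set 𝓤
    _≤_       : Carrier → Carrier → Set 𝓣
    ≤-prop    : ∀ x y → is-prop (x ≤ y)
    ≤-refl    : ∀ x → x ≤ x
    ≤-trans   : ∀ {x y z} → x ≤ y → y ≤ z → x ≤ z
    ≤-antisym : ∀ {x y} → x ≤ y → y ≤ x → x ≡ y

Ω : (𝓣 : Level) → Set (suc 𝓣)
Ω 𝓣 = Σ (Set 𝓣) is-prop

Subset : ∀ {𝓤} (𝓣 : Level) → Set 𝓤 → Set (𝓤 ⊔ suc 𝓣)
Subset 𝓣 X = X → Ω 𝓣

_∈_ : ∀ {𝓤 𝓣} {X : Set 𝓤} → X → Subset 𝓣 X → Set 𝓣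
x ∈ S = proj₁ (S x)

𝕋 : ∀ {𝓤 𝓣} {X : Set 𝓤} → Subset 𝓣 X → Set (𝓤 ⊔ 𝓣)
𝕋 {X = X} S = Σ X (λ x → x ∈ S)

module _ (pt : PropTrunc) where
  open PropTrunc pt

  is-surjection : ∀ {a b} {A : Set a} {B : Set b} → (A → B) → Set (a ⊔ b)
  is-surjection {A = A} f = ∀ b → ∥ Σ A (λ a → f a ≡ b) ∥

  is-covered : ∀ {𝓤 𝓣} (𝓥 : Level) {X : Set 𝓤} → Subset 𝓣 X → Set (𝓤 ⊔ 𝓣 ⊔ suc 𝓥)
  is-covered 𝓥 S = ∥ Σ (Set 𝓥) (λ I → Σ (I → 𝕋 S) is-surjection) ∥

module _ {𝓤 𝓣} (P : Poset 𝓤 𝓣) where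
  open Poset P

  is-sup-of-subset : ∀ {𝓦} → Subset 𝓦 Carrier → Carrier → Set (𝓤 ⊔ 𝓣 ⊔ 𝓦)
  is-sup-of-subset S s =
    (∀ x → x ∈ S → x ≤ s) × (∀ u → (∀ x → x ∈ S → x ≤ u) → s ≤ u)

  is-sup-of-family : ∀ {𝓥} {I : Set 𝓥} → (I → Carrier) → Carrier → Set (𝓤 ⊔ 𝓣 ⊔ 𝓥)
  is-sup-of-family α s =
    (∀ i → α i ≤ s) × (∀ u → (∀ i → α i ≤ u) → s ≤ u)

  has-sups-of-covered-subsets : PropTrunc → (𝓥 : Level) → Set (suc (𝓤 ⊔ 𝓥) ⊔ 𝓣)
  has-sups-of-covered-subsets pt 𝓥 =
    (S : Subset (𝓤 ⊔ 𝓥) Carrier) → is-covered pt 𝓥 S → Σ Carrier (is-sup-of-subset S)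

  has-sups-of-families : (𝓥 : Level) → Set (𝓤 ⊔ 𝓣 ⊔ suc 𝓥)
  has-sups-of-families 𝓥 =
    (I : Set 𝓥) (α : I → Carrier) → Σ Carrier (is-sup-of-family α)

{-# OPTIONS --safe #-}
module Submission where

open import Defs
open import Level using (Level; _⊔_)
open import Function.Base using (_∘_)
open import Function.Bundles using (_⇔_; mk⇔; Equivalence)
open import Data.Product using (Σ; _×_; _,_; proj₁; proj₂)
open import Relation.Binary.PropositionalEquality using (_≡_; refl; cong; cong₂; subst)

-- A family α : I → X and the 𝓥-covered subsets of X are two presentations of the same
-- data: α has the same upper bounds as its image, which is covered by I, and a subset
-- covered by e : I ↠ 𝕋 S has the same upper bounds as the family proj₁ ∘ e. Going from a
-- cover to a family requires choosing the cover, which is legitimate because suprema are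
-- unique, so the type of suprema of S is a proposition.

Π-is-prop : FunExt → ∀ {a b} {A : Set a} {B : A → Set b} →
            (∀ x → is-prop (B x)) → is-prop ((x : A) → B x)
Π-is-prop fe h f g = fe (λ x → h x (f x) (g x))

×-is-prop : ∀ {a b} {A : Set a} {B : Set b} → is-prop A → is-prop B → is-prop (A × B)
×-is-prop pa pb (a , b) (a' , b') = cong₂ _,_ (pa a a') (pb b b')

module _ (pt : PropTrunc) where
  open PropTrunc pt

  image : ∀ {a b} {A : Set a} {B : Set b} → (A → B) → Subset (a ⊔ b) B
  image {A = A} f y = ∥ Σ A (λ x → f x ≡ y) ∥ , ∥∥-is-prop

  corestriction : ∀ {a b} {A : Set a} {B : Set b} (f : A → B) → A → 𝕋 (image f)
  corestriction f x = f x , ∣ x , refl ∣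

  corestriction-is-surjection : ∀ {a b} {A : Set a} {B : Set b} (f : A → B) →
                                is-surjection pt (corestriction f)
  corestriction-is-surjection {A = A} f (y , m) = ∥∥-rec ∥∥-is-prop (preimage m) m
    where
    preimage : ∀ {y} (m : y ∈ image f) → Σ A (λ x → f x ≡ y) →
               ∥ Σ A (λ x → corestriction f x ≡ (y , m)) ∥
    preimage m (x , refl) = ∣ x , cong (f x ,_) (∥∥-is-prop _ _) ∣

module _ {𝓤 𝓣} (X : Poset 𝓤 𝓣) where
  open Poset X

  sup-of-subset-is-prop : FunExt → ∀ {𝓦} (S : Subset 𝓦 Carrier) →
                          is-prop (Σ Carrier (is-sup-of-subset X S))
  sup-of-subset-is-prop fe S (s , p) (t , q) =
    pair≡ (≤-antisym (proj₂ p t (proj₁ q)) (proj₂ q s (proj₁ p))) p q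
    where
    is-sup-is-prop : ∀ s → is-prop (is-sup-of-subset X S s)
    is-sup-is-prop s = ×-is-prop (Π-is-prop fe λ x → Π-is-prop fe λ _ → ≤-prop x s)
                                 (Π-is-prop fe λ u → Π-is-prop fe λ _ → ≤-prop s u)
    pair≡ : ∀ {s t} → s ≡ t → (p : is-sup-of-subset X S s) (q : is-sup-of-subset X S t) →
            (s , p) ≡ (t , q)
    pair≡ {s} refl p q = cong (s ,_) (is-sup-is-prop s p q)

  module _ (pt : PropTrunc) where
    open PropTrunc pt

    sup-of-subset⇔sup-of-covering-family :
      ∀ {𝓥 𝓦} {I : Set 𝓥} (S : Subset 𝓦 Carrier) (e : I → 𝕋 S) → is-surjection pt e →
      ∀ s → is-sup-of-subset X S s ⇔ is-sup-of-family X (proj₁ ∘ e) s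
    sup-of-subset⇔sup-of-covering-family S e e-surj s = mk⇔
      (λ (ub , lub) → (λ i → ub _ (proj₂ (e i))) , (λ u → lub u ∘ bounds-covered-elements u))
      (λ (ub , lub) → bounds-covered-elements s ub , (λ u h → lub u λ i → h _ (proj₂ (e i))))
      where
      bounds-covered-elements : ∀ u → (∀ i → proj₁ (e i) ≤ u) → ∀ x → x ∈ S → x ≤ u
      bounds-covered-elements u h x m =
        ∥∥-rec (≤-prop x u) (λ (i , p) → subst (_≤ u) (cong proj₁ p) (h i)) (e-surj (x , m))

corollary6p8 : FunExt → (pt : PropTrunc) → ∀ {𝓤 𝓣} (X : Poset 𝓤 𝓣) (𝓥 : Level) →
    has-sups-of-covered-subsets X pt 𝓥 ⇔ has-sups-of-families X 𝓥
corollary6p8 fe pt X 𝓥 = mk⇔ families-from-subsets subsets-from-families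
  where
  open PropTrunc pt
  open Equivalence using (to; from)

  families-from-subsets : has-sups-of-covered-subsets X pt 𝓥 → has-sups-of-families X 𝓥
  families-from-subsets H I α =
    let s , s-sup = H (image pt α) ∣ I , corestriction pt α , corestriction-is-surjection pt α ∣
    in s , to (sup-of-subset⇔sup-of-covering-family X pt (image pt α) (corestriction pt α)
                 (corestriction-is-surjection pt α) s) s-sup

  subsets-from-families : has-sups-of-families X 𝓥 → has-sups-of-covered-subsets X pt 𝓥
  subsets-from-families H S = ∥∥-rec (sup-of-subset-is-prop X fe S) λ (I , e , e-surj) →
    let s , s-sup = H I (proj₁ ∘ e)
    in s , from (sup-of-subset⇔sup-of-covering-family X pt S e e-surj s) s-sup
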